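{- Every term $f\colon I\vdash I$ is equal to $\mathbf 1_I$.
   Context: Formulae are built from an infinite set of propositional letters and a constant $I$ using binary connectives $\otimes$ and $\to$. An $\alpha$-formula is a formula considered up to strict associativity of $\otimes$ and strict unitality of $I$ ($A\otimes(B\otimes C)=(A\otimes B)\otimes C$, $A\otimes I=I\otimes A=A$, also inside subformulae). Terms with types $f\colon A\vdash B$ ($A,B$ $\alpha$-formulae): primitive $\mathbf 1_A\colon A\vdash A$, $c_{B,A}\colon B\otimes A\vdash A\otimes B$, $\eta_{A,B}\colon B\vdash A\to(A\otimes B)$, $\varepsilon_{A,B}\colon A\otimes(A\to B)\vdash B$; closed under $g\circ f$ (for $f\colon A\vdash B$, $g\colon B\vdash C$), $f_1\otimes f_2\colon A_1\otimes A_2\vdash B_1\otimes B_2$, and $A\to f\colon A\to B_1\vdash A\to B_2$ (for $f\colon B_1\vdash B_2$); strictly $f\otimes(g\otimes h)=(f\otimes g)\otimes h$, $f\otimes\mathbf 1_I=\mathbf 1_I\otimes f=f$. Equality of terms is the smallest congruence (only between terms of the same type) containing: $g\circ\mathbf 1_A=g$, $\mathbf 1_A\circ f=f$; $h\circ(g\circ f)=(h\circ g)\circ f$; $\mathbf 1_A\otimes\mathbf 1_B=\mathbf 1_{A\otimes B}$; $(g_1\otimes g_2)\circ(f_1\otimes f_2)=(g_1\circ f_1)\otimes(g_2\circ f_2)$; $c_{A',B'}\circ(f\otimes g)=(g\otimes f)\circ c_{A,B}$ ($f\colon A\vdash A'$, $g\colon B\vdash B'$); $c_{B,A}\circ c_{A,B}=\mathbf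 1_{A\otimes B}$; $c_{A\otimes B,C}=(c_{A,C}\otimes\mathbf 1_B)\circ(\mathbf 1_A\otimes c_{B,C})$; $A\to(g\circ f)=(A\to g)\circ(A\to f)$; $\eta_{A,B'}\circ f=(A\to(\mathbf 1_A\otimes f))\circ\eta_{A,B}$ ($f\colon B\vdash B'$); $A\to\mathbf 1_B=\mathbf 1_{A\to B}$; $\varepsilon_{A,B'}\circ(\mathbf 1_A\otimes(A\to f))=f\circ\varepsilon_{A,B}$ ($f\colon B\vdash B'$); $\varepsilon_{A,A\otimes B}\circ(\mathbf 1_A\otimes\eta_{A,B})=\mathbf 1_{A\otimes B}$; $(A\to\varepsilon_{A,B})\circ\eta_{A,A\to B}=\mathbf 1_{A\to B}$. -}

module Defs where

open import Data.Nat using (ℕ)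
open import Data.List using (List; []; _∷_; _++_)

-- An α-formula (formula modulo strict associativity of ⊗ and strict
-- unitality of I, also inside subformulae) is represented by the list of
-- its ⊗-factors, each of which is a propositional letter or an
-- implication between α-formulae.

data Atom : Set where
  var : ℕ → Atom
  imp : List Atom → List Atom → Atom

Form : Set
Form = List Atom

I : Form
I = []

infixr 7 _⊗_
_⊗_ : Form → Form → Form
A ⊗ B = A ++ B

infixr 6 _⇒_
_⇒_ : Form → Form → Form
A ⇒ B = imp A B ∷ []

infixr 9 _∘t_
infixr 7 _⊗t_
infixr 6 _⇒t_

data Term : Set where
  𝟙    : Form → Term
  c    : Form → Form → Term
  η    : Form → Form → Term
  ε    : Form → Form → Term
  _∘t_ : Term → Term → Term
  _⊗t_ : Term → Term → Term
  _⇒t_ : Form → Term → Term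

infix 4 _∶_⊢_
data _∶_⊢_ : Term → Form → Form → Set where
  t-𝟙 : ∀ A → 𝟙 A ∶ A ⊢ A
  t-c : ∀ B A → c B A ∶ B ⊗ A ⊢ A ⊗ B
  t-η : ∀ A B → η A B ∶ B ⊢ A ⇒ (A ⊗ B)
  t-ε : ∀ A B → ε A B ∶ A ⊗ (A ⇒ B) ⊢ B
  t-∘ : ∀ {f g A B C} → f ∶ A ⊢ B → g ∶ B ⊢ C → g ∘t f ∶ A ⊢ C
  t-⊗ : ∀ {f₁ f₂ A₁ A₂ B₁ B₂} → f₁ ∶ A₁ ⊢ B₁ → f₂ ∶ A₂ ⊢ B₂
      → f₁ ⊗t f₂ ∶ A₁ ⊗ A₂ ⊢ B₁ ⊗ B₂
  t-⇒ : ∀ A {f B₁ B₂} → f ∶ B₁ ⊢ B₂ → A ⇒t f ∶ A ⇒ B₁ ⊢ A ⇒ B₂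

-- The strict identifications of terms
-- f ⊗ (g ⊗ h) = (f ⊗ g) ⊗ h and f ⊗ 1_I = 1_I ⊗ f = f are included as
-- generators (this yields the same quotient).

data Eq : Form → Form → Term → Term → Set where
  ≈-refl  : ∀ {A B f} → f ∶ A ⊢ B → Eq A B f f
  ≈-sym   : ∀ {A B f g} → Eq A B f g → Eq A B g f
  ≈-trans : ∀ {A B f g h} → Eq A B f g → Eq A B g h → Eq A B f h
  ∘-cong  : ∀ {A B C f f' g g'} → Eq A B f f' → Eq B C g g'
          → Eq A C (g ∘t f) (g' ∘t f')
  ⊗-cong  : ∀ {A₁ A₂ B₁ B₂ f₁ f₁' f₂ f₂'} → Eq A₁ B₁ f₁ f₁' → Eq A₂ B₂ f₂ f₂'
          → Eq (A₁ ⊗ A₂) (B₁ ⊗ B₂) (f₁ ⊗t f₂) (f₁' ⊗t f₂')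
  ⇒-cong  : ∀ A {B₁ B₂ f f'} → Eq B₁ B₂ f f'
          → Eq (A ⇒ B₁) (A ⇒ B₂) (A ⇒t f) (A ⇒t f')
  ⊗-assoc : ∀ {A₁ A₂ A₃ B₁ B₂ B₃ f g h}
          → f ∶ A₁ ⊢ B₁ → g ∶ A₂ ⊢ B₂ → h ∶ A₃ ⊢ B₃
          → Eq (A₁ ⊗ A₂ ⊗ A₃) (B₁ ⊗ B₂ ⊗ B₃) (f ⊗t (g ⊗t h)) ((f ⊗t g) ⊗t h)
  ⊗-unitʳ : ∀ {A B f} → f ∶ A ⊢ B → Eq A B (f ⊗t 𝟙 I) f
  ⊗-unitˡ : ∀ {A B f} → f ∶ A ⊢ B → Eq A B (𝟙 I ⊗t f) f
  idʳ     : ∀ {A B g} → g ∶ A ⊢ B → Eq A B (g ∘t 𝟙 A) g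
  idˡ     : ∀ {A B f} → f ∶ A ⊢ B → Eq A B (𝟙 B ∘t f) f
  assoc   : ∀ {A B C D f g h} → f ∶ A ⊢ B → g ∶ B ⊢ C → h ∶ C ⊢ D
          → Eq A D (h ∘t (g ∘t f)) ((h ∘t g) ∘t f)
  ⊗-id    : ∀ A B → Eq (A ⊗ B) (A ⊗ B) (𝟙 A ⊗t 𝟙 B) (𝟙 (A ⊗ B))
  ⊗-∘     : ∀ {A₁ A₂ B₁ B₂ C₁ C₂ f₁ f₂ g₁ g₂}
          → f₁ ∶ A₁ ⊢ B₁ → g₁ ∶ B₁ ⊢ C₁ → f₂ ∶ A₂ ⊢ B₂ → g₂ ∶ B₂ ⊢ C₂
          → Eq (A₁ ⊗ A₂) (C₁ ⊗ C₂) ((g₁ ⊗t g₂) ∘t (f₁ ⊗t f₂))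
                                   ((g₁ ∘t f₁) ⊗t (g₂ ∘t f₂))
  c-nat   : ∀ {A A' B B' f g} → f ∶ A ⊢ A' → g ∶ B ⊢ B'
          → Eq (A ⊗ B) (B' ⊗ A') (c A' B' ∘t (f ⊗t g)) ((g ⊗t f) ∘t c A B)
  c-inv   : ∀ A B → Eq (A ⊗ B) (A ⊗ B) (c B A ∘t c A B) (𝟙 (A ⊗ B))
  c-hex   : ∀ A B C → Eq ((A ⊗ B) ⊗ C) (C ⊗ (A ⊗ B)) (c (A ⊗ B) C)
                         ((c A C ⊗t 𝟙 B) ∘t (𝟙 A ⊗t c B C))
  ⇒-∘     : ∀ A {B₁ B₂ B₃ f g} → f ∶ B₁ ⊢ B₂ → g ∶ B₂ ⊢ B₃
          → Eq (A ⇒ B₁) (A ⇒ B₃) (A ⇒t (g ∘t f)) ((A ⇒t g) ∘t (A ⇒t f))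
  η-nat   : ∀ A {B B' f} → f ∶ B ⊢ B'
          → Eq B (A ⇒ (A ⊗ B')) (η A B' ∘t f) ((A ⇒t (𝟙 A ⊗t f)) ∘t η A B)
  ⇒-id    : ∀ A B → Eq (A ⇒ B) (A ⇒ B) (A ⇒t 𝟙 B) (𝟙 (A ⇒ B))
  ε-nat   : ∀ A {B B' f} → f ∶ B ⊢ B'
          → Eq (A ⊗ (A ⇒ B)) B' (ε A B' ∘t (𝟙 A ⊗t (A ⇒t f))) (f ∘t ε A B)
  triangle₁ : ∀ A B → Eq (A ⊗ B) (A ⊗ B) (ε A (A ⊗ B) ∘t (𝟙 A ⊗t η A B)) (𝟙 (A ⊗ B))
  triangle₂ : ∀ A B → Eq (A ⇒ B) (A ⇒ B) ((A ⇒t ε A B) ∘t η A (A ⇒ B)) (𝟙 (A ⇒ B))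

{-# OPTIONS --safe #-}
-- A logical predicate on global elements x : I ⊢ A.  No global element of a
-- propositional letter qualifies; at A → B qualify those h for which
-- ε ∘ (y ⊗ h) qualifies at B whenever y qualifies at A; at a ⊗-product those
-- equal to a tensor of qualifying factors, so at I exactly those equal to 1_I.
-- Each primitive, and each constructor applied to preserving terms, sends
-- qualifying elements to qualifying ones.  Since 1_I qualifies at I, so does
-- f ∘ 1_I for f : I ⊢ I, that is, f = 1_I.
module Submission where

open import Defs
open import Data.Empty using (⊥)
open import Data.Product using (Σ-syntax; _×_; _,_; proj₁; proj₂)
open import Data.List using ([]; _∷_; _++_)
open import Data.List.Properties using (++-assoc; ++-identityʳ)
open import Level using (0ℓ)
open import Relation.Binary.Bundles using (PartialSetoid)
open import Relation.Binary.PropositionalEquality using (_≡_; refl; sym; subst₂)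
import Relation.Binary.Reasoning.PartialSetoid as PartialSetoidReasoning

⊢-subst : ∀ {f A B A′ B′} → A ≡ A′ → B ≡ B′ → f ∶ A ⊢ B → f ∶ A′ ⊢ B′
⊢-subst {f} = subst₂ (λ A B → f ∶ A ⊢ B)

Eq-typed : ∀ {A B f g} → Eq A B f g → f ∶ A ⊢ B × g ∶ A ⊢ B
Eq-typed (≈-refl t) = t , t
Eq-typed (≈-sym p) = proj₂ (Eq-typed p) , proj₁ (Eq-typed p)
Eq-typed (≈-trans p q) = proj₁ (Eq-typed p) , proj₂ (Eq-typed q)
Eq-typed (∘-cong p q) =
  t-∘ (proj₁ (Eq-typed p)) (proj₁ (Eq-typed q)) , t-∘ (proj₂ (Eq-typed p)) (proj₂ (Eq-typed q))
Eq-typed (⊗-cong p q) =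
  t-⊗ (proj₁ (Eq-typed p)) (proj₁ (Eq-typed q)) , t-⊗ (proj₂ (Eq-typed p)) (proj₂ (Eq-typed q))
Eq-typed (⇒-cong A p) = t-⇒ A (proj₁ (Eq-typed p)) , t-⇒ A (proj₂ (Eq-typed p))
Eq-typed (⊗-assoc {A₁} {A₂} {A₃} {B₁} {B₂} {B₃} tf tg th) =
  t-⊗ tf (t-⊗ tg th) , ⊢-subst (++-assoc A₁ A₂ A₃) (++-assoc B₁ B₂ B₃) (t-⊗ (t-⊗ tf tg) th)
Eq-typed (⊗-unitʳ {A} {B} tf) = ⊢-subst (++-identityʳ A) (++-identityʳ B) (t-⊗ tf (t-𝟙 I)) , tf
Eq-typed (⊗-unitˡ tf) = t-⊗ (t-𝟙 I) tf , tf
Eq-typed (idʳ {A} tg) = t-∘ (t-𝟙 A) tg , tg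
Eq-typed (idˡ {B = B} tf) = t-∘ tf (t-𝟙 B) , tf
Eq-typed (assoc tf tg th) = t-∘ (t-∘ tf tg) th , t-∘ tf (t-∘ tg th)
Eq-typed (⊗-id A B) = t-⊗ (t-𝟙 A) (t-𝟙 B) , t-𝟙 (A ⊗ B)
Eq-typed (⊗-∘ tf₁ tg₁ tf₂ tg₂) =
  t-∘ (t-⊗ tf₁ tf₂) (t-⊗ tg₁ tg₂) , t-⊗ (t-∘ tf₁ tg₁) (t-∘ tf₂ tg₂)
Eq-typed (c-nat {A} {A′} {B} {B′} tf tg) = t-∘ (t-⊗ tf tg) (t-c A′ B′) , t-∘ (t-c A B) (t-⊗ tg tf)
Eq-typed (c-inv A B) = t-∘ (t-c A B) (t-c B A) , t-𝟙 (A ⊗ B)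
Eq-typed (c-hex A B C) =
  t-c (A ⊗ B) C ,
  t-∘ (⊢-subst (sym (++-assoc A B C)) (sym (++-assoc A C B)) (t-⊗ (t-𝟙 A) (t-c B C)))
      (⊢-subst refl (++-assoc C A B) (t-⊗ (t-c A C) (t-𝟙 B)))
Eq-typed (⇒-∘ A tf tg) = t-⇒ A (t-∘ tf tg) , t-∘ (t-⇒ A tf) (t-⇒ A tg)
Eq-typed (η-nat A {B} {B′} tf) = t-∘ tf (t-η A B′) , t-∘ (t-η A B) (t-⇒ A (t-⊗ (t-𝟙 A) tf))
Eq-typed (⇒-id A B) = t-⇒ A (t-𝟙 B) , t-𝟙 (A ⇒ B)
Eq-typed (ε-nat A {B} {B′} tf) = t-∘ (t-⊗ (t-𝟙 A) (t-⇒ A tf)) (t-ε A B′) , t-∘ (t-ε A B) tf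
Eq-typed (triangle₁ A B) = t-∘ (t-⊗ (t-𝟙 A) (t-η A B)) (t-ε A (A ⊗ B)) , t-𝟙 (A ⊗ B)
Eq-typed (triangle₂ A B) = t-∘ (t-η A (A ⇒ B)) (t-⇒ A (t-ε A B)) , t-𝟙 (A ⇒ B)

homs : Form → Form → PartialSetoid 0ℓ 0ℓ
homs A B = record
  { Carrier = Term
  ; _≈_ = Eq A B
  ; isPartialEquivalence = record { sym = ≈-sym ; trans = ≈-trans }
  }

module ≈-Reasoning {A B : Form} = PartialSetoidReasoning (homs A B)
open ≈-Reasoning

∘-congˡ : ∀ {A B C f g g′} → f ∶ A ⊢ B → Eq B C g g′ → Eq A C (g ∘t f) (g′ ∘t f)
∘-congˡ tf = ∘-cong (≈-refl tf)

∘-congʳ : ∀ {A B C f f′ g} → g ∶ B ⊢ C → Eq A B f f′ → Eq A C (g ∘t f) (g ∘t f′)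
∘-congʳ tg p = ∘-cong p (≈-refl tg)

⊗-congʳ : ∀ {A₁ A₂ B₁ B₂ f f₂ f₂′} → f ∶ A₁ ⊢ B₁ → Eq A₂ B₂ f₂ f₂′
        → Eq (A₁ ⊗ A₂) (B₁ ⊗ B₂) (f ⊗t f₂) (f ⊗t f₂′)
⊗-congʳ tf = ⊗-cong (≈-refl tf)

c-I-I : Eq I I (c I I) (𝟙 I)
c-I-I = begin
  c I I                            ≈⟨ c-hex I I I ⟩
  (c I I ⊗t 𝟙 I) ∘t (𝟙 I ⊗t c I I) ≈⟨ ∘-cong (⊗-unitˡ (t-c I I)) (⊗-unitʳ (t-c I I)) ⟩
  c I I ∘t c I I                   ≈⟨ c-inv I I ⟩
  𝟙 I                              ∎

mutual
  ReducibleAtom : Atom → Term → Set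
  ReducibleAtom (var n)   h = ⊥
  ReducibleAtom (imp A B) h =
    h ∶ I ⊢ A ⇒ B × (∀ y → Reducible A y → Reducible B (ε A B ∘t (y ⊗t h)))

  Reducible : Form → Term → Set
  Reducible []      x = Eq I I x (𝟙 I)
  Reducible (a ∷ A) x =
    Σ[ y ∈ Term ] Σ[ z ∈ Term ] ReducibleAtom a y × Reducible A z × Eq I (a ∷ A) x (y ⊗t z)

ReducibleAtom-typed : ∀ a {h} → ReducibleAtom a h → h ∶ I ⊢ a ∷ []
ReducibleAtom-typed (imp A B) (th , _) = th

Reducible-typed : ∀ A {x} → Reducible A x → x ∶ I ⊢ A
Reducible-typed []      x≈𝟙               = proj₁ (Eq-typed x≈𝟙)
Reducible-typed (a ∷ A) (_ , _ , _ , _ , x≈y⊗z) = proj₁ (Eq-typed x≈y⊗z)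

Reducible-resp-≈ : ∀ A {x x′} → Eq I A x x′ → Reducible A x → Reducible A x′
Reducible-resp-≈ []      x≈x′ x≈𝟙 = ≈-trans (≈-sym x≈x′) x≈𝟙
Reducible-resp-≈ (a ∷ A) x≈x′ (y , z , ry , rz , x≈y⊗z) =
  y , z , ry , rz , ≈-trans (≈-sym x≈x′) x≈y⊗z

Reducible-atom⁺ : ∀ a {h} → ReducibleAtom a h → Reducible (a ∷ []) h
Reducible-atom⁺ a rh = _ , 𝟙 I , rh , ≈-refl (t-𝟙 I) , ≈-sym (⊗-unitʳ (ReducibleAtom-typed a rh))

Reducible-atom⁻ : ∀ a {x} → Reducible (a ∷ []) x → Σ[ h ∈ Term ] ReducibleAtom a h × Eq I (a ∷ []) x h
Reducible-atom⁻ a (h , z , rh , z≈𝟙 , x≈h⊗z) =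
  h , rh , ≈-trans x≈h⊗z (≈-trans (⊗-congʳ th z≈𝟙) (⊗-unitʳ th))
  where th = ReducibleAtom-typed a rh

Reducible-++⁺ : ∀ A B {y z} → Reducible A y → Reducible B z → Reducible (A ++ B) (y ⊗t z)
Reducible-++⁺ [] B {y} {z} y≈𝟙 rz = Reducible-resp-≈ B z≈y⊗z rz
  where
  tz = Reducible-typed B rz
  z≈y⊗z : Eq I B z (y ⊗t z)
  z≈y⊗z = ≈-sym (≈-trans (⊗-cong y≈𝟙 (≈-refl tz)) (⊗-unitˡ tz))
Reducible-++⁺ (a ∷ A) B (u , v , ru , rv , y≈u⊗v) rz =
  u , _ , ru , Reducible-++⁺ A B rv rz ,
  ≈-trans (⊗-cong y≈u⊗v (≈-refl tz)) (≈-sym (⊗-assoc tu tv tz))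
  where
  tu = ReducibleAtom-typed a ru
  tv = Reducible-typed A rv
  tz = Reducible-typed B rz

Reducible-++⁻ : ∀ A B {x} → Reducible (A ++ B) x
              → Σ[ y ∈ Term ] Σ[ z ∈ Term ] Reducible A y × Reducible B z × Eq I (A ++ B) x (y ⊗t z)
Reducible-++⁻ [] B rx = 𝟙 I , _ , ≈-refl (t-𝟙 I) , rx , ≈-sym (⊗-unitˡ (Reducible-typed B rx))
Reducible-++⁻ (a ∷ A) B (u , v , ru , rv , x≈u⊗v) with Reducible-++⁻ A B rv
... | y , z , ry , rz , v≈y⊗z =
  u ⊗t y , z , (u , y , ru , ry , ≈-refl (t-⊗ tu ty)) , rz ,
  ≈-trans x≈u⊗v (≈-trans (⊗-congʳ tu v≈y⊗z) (⊗-assoc tu ty (Reducible-typed B rz)))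
  where
  tu = ReducibleAtom-typed a ru
  ty = Reducible-typed A ry

PreservesReducible : Term → Form → Form → Set
PreservesReducible f A B = ∀ {x} → Reducible A x → Reducible B (f ∘t x)

𝟙-preserves : ∀ A → PreservesReducible (𝟙 A) A A
𝟙-preserves A rx = Reducible-resp-≈ A (≈-sym (idˡ (Reducible-typed A rx))) rx

∘-preserves : ∀ {A B C f g} → f ∶ A ⊢ B → g ∶ B ⊢ C
            → PreservesReducible f A B → PreservesReducible g B C
            → PreservesReducible (g ∘t f) A C
∘-preserves {A} {C = C} tf tg pf pg rx =
  Reducible-resp-≈ C (assoc (Reducible-typed A rx) tf tg) (pg (pf rx))

c-preserves : ∀ B A → PreservesReducible (c B A) (B ⊗ A) (A ⊗ B)
c-preserves B A {x} rx with Reducible-++⁻ B A rx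
... | y , z , ry , rz , x≈y⊗z =
  Reducible-resp-≈ (A ⊗ B) (≈-sym c∘x≈z⊗y) (Reducible-++⁺ A B rz ry)
  where
  ty = Reducible-typed B ry
  tz = Reducible-typed A rz
  c∘x≈z⊗y : Eq I (A ⊗ B) (c B A ∘t x) (z ⊗t y)
  c∘x≈z⊗y = begin
    c B A ∘t x           ≈⟨ ∘-congʳ (t-c B A) x≈y⊗z ⟩
    c B A ∘t (y ⊗t z)    ≈⟨ c-nat ty tz ⟩
    (z ⊗t y) ∘t c I I    ≈⟨ ∘-congʳ (t-⊗ tz ty) c-I-I ⟩
    (z ⊗t y) ∘t 𝟙 I      ≈⟨ idʳ (t-⊗ tz ty) ⟩
    z ⊗t y               ∎

η-preserves : ∀ A B → PreservesReducible (η A B) B (A ⇒ A ⊗ B)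
η-preserves A B {x} rx = Reducible-atom⁺ (imp A (A ⊗ B)) (t-∘ tx (t-η A B) , ε∘η-reducible)
  where
  tx = Reducible-typed B rx
  ε∘η-reducible : ∀ y → Reducible A y → Reducible (A ⊗ B) (ε A (A ⊗ B) ∘t (y ⊗t (η A B ∘t x)))
  ε∘η-reducible y ry = Reducible-resp-≈ (A ⊗ B) (≈-sym ε∘y⊗η∘x≈y⊗x) (Reducible-++⁺ A B ry rx)
    where
    ty = Reducible-typed A ry
    ε∘y⊗η∘x≈y⊗x : Eq I (A ⊗ B) (ε A (A ⊗ B) ∘t (y ⊗t (η A B ∘t x))) (y ⊗t x)
    ε∘y⊗η∘x≈y⊗x = begin
      ε A (A ⊗ B) ∘t (y ⊗t (η A B ∘t x))
        ≈⟨ ∘-congʳ (t-ε A (A ⊗ B)) (⊗-cong (idˡ ty) (≈-refl (t-∘ tx (t-η A B)))) ⟨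
      ε A (A ⊗ B) ∘t ((𝟙 A ∘t y) ⊗t (η A B ∘t x))
        ≈⟨ ∘-congʳ (t-ε A (A ⊗ B)) (⊗-∘ ty (t-𝟙 A) tx (t-η A B)) ⟨
      ε A (A ⊗ B) ∘t ((𝟙 A ⊗t η A B) ∘t (y ⊗t x))
        ≈⟨ assoc (t-⊗ ty tx) (t-⊗ (t-𝟙 A) (t-η A B)) (t-ε A (A ⊗ B)) ⟩
      (ε A (A ⊗ B) ∘t (𝟙 A ⊗t η A B)) ∘t (y ⊗t x)
        ≈⟨ ∘-congˡ (t-⊗ ty tx) (triangle₁ A B) ⟩
      𝟙 (A ⊗ B) ∘t (y ⊗t x)
        ≈⟨ idˡ (t-⊗ ty tx) ⟩
      y ⊗t x ∎

ε-preserves : ∀ A B → PreservesReducible (ε A B) (A ⊗ (A ⇒ B)) B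
ε-preserves A B {x} rx with Reducible-++⁻ A (A ⇒ B) rx
... | y , z , ry , rz , x≈y⊗z with Reducible-atom⁻ (imp A B) rz
... | h , (_ , ε∘-reducible) , z≈h =
  Reducible-resp-≈ B ε∘y⊗h≈ε∘x (ε∘-reducible y ry)
  where
  ε∘y⊗h≈ε∘x : Eq I B (ε A B ∘t (y ⊗t h)) (ε A B ∘t x)
  ε∘y⊗h≈ε∘x = ∘-congʳ (t-ε A B) (≈-sym (≈-trans x≈y⊗z (⊗-congʳ (Reducible-typed A ry) z≈h)))

⊗-preserves : ∀ {A₁ A₂ B₁ B₂ f₁ f₂} → f₁ ∶ A₁ ⊢ B₁ → f₂ ∶ A₂ ⊢ B₂
            → PreservesReducible f₁ A₁ B₁ → PreservesReducible f₂ A₂ B₂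
            → PreservesReducible (f₁ ⊗t f₂) (A₁ ⊗ A₂) (B₁ ⊗ B₂)
⊗-preserves {A₁} {A₂} {B₁} {B₂} tf₁ tf₂ pf₁ pf₂ rx with Reducible-++⁻ A₁ A₂ rx
... | y , z , ry , rz , x≈y⊗z =
  Reducible-resp-≈ (B₁ ⊗ B₂)
    (≈-trans (≈-sym (⊗-∘ (Reducible-typed A₁ ry) tf₁ (Reducible-typed A₂ rz) tf₂))
             (∘-congʳ (t-⊗ tf₁ tf₂) (≈-sym x≈y⊗z)))
    (Reducible-++⁺ B₁ B₂ (pf₁ ry) (pf₂ rz))

⇒-preserves : ∀ A {B₁ B₂ f} → f ∶ B₁ ⊢ B₂ → PreservesReducible f B₁ B₂
            → PreservesReducible (A ⇒t f) (A ⇒ B₁) (A ⇒ B₂)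
⇒-preserves A {B₁} {B₂} {f} tf pf rx with Reducible-atom⁻ (imp A B₁) rx
... | h , (th , ε∘-reducible) , x≈h =
  Reducible-resp-≈ (A ⇒ B₂) (≈-sym (∘-congʳ (t-⇒ A tf) x≈h))
    (Reducible-atom⁺ (imp A B₂) (t-∘ th (t-⇒ A tf) , ε∘-reducible′))
  where
  ε∘-reducible′ : ∀ y → Reducible A y → Reducible B₂ (ε A B₂ ∘t (y ⊗t ((A ⇒t f) ∘t h)))
  ε∘-reducible′ y ry = Reducible-resp-≈ B₂ f∘ε∘y⊗h≈ε∘y⊗f∘h (pf (ε∘-reducible y ry))
    where
    ty = Reducible-typed A ry
    f∘ε∘y⊗h≈ε∘y⊗f∘h : Eq I B₂ (f ∘t (ε A B₁ ∘t (y ⊗t h))) (ε A B₂ ∘t (y ⊗t ((A ⇒t f) ∘t h)))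
    f∘ε∘y⊗h≈ε∘y⊗f∘h = begin
      f ∘t (ε A B₁ ∘t (y ⊗t h))
        ≈⟨ assoc (t-⊗ ty th) (t-ε A B₁) tf ⟩
      (f ∘t ε A B₁) ∘t (y ⊗t h)
        ≈⟨ ∘-congˡ (t-⊗ ty th) (ε-nat A tf) ⟨
      (ε A B₂ ∘t (𝟙 A ⊗t (A ⇒t f))) ∘t (y ⊗t h)
        ≈⟨ assoc (t-⊗ ty th) (t-⊗ (t-𝟙 A) (t-⇒ A tf)) (t-ε A B₂) ⟨
      ε A B₂ ∘t ((𝟙 A ⊗t (A ⇒t f)) ∘t (y ⊗t h))
        ≈⟨ ∘-congʳ (t-ε A B₂) (⊗-∘ ty (t-𝟙 A) th (t-⇒ A tf)) ⟩
      ε A B₂ ∘t ((𝟙 A ∘t y) ⊗t ((A ⇒t f) ∘t h))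
        ≈⟨ ∘-congʳ (t-ε A B₂) (⊗-cong (idˡ ty) (≈-refl (t-∘ th (t-⇒ A tf)))) ⟩
      ε A B₂ ∘t (y ⊗t ((A ⇒t f) ∘t h)) ∎

preservesReducible : ∀ {f A B} → f ∶ A ⊢ B → PreservesReducible f A B
preservesReducible (t-𝟙 A)       = 𝟙-preserves A
preservesReducible (t-c B A)     = c-preserves B A
preservesReducible (t-η A B)     = η-preserves A B
preservesReducible (t-ε A B)     = ε-preserves A B
preservesReducible (t-∘ tf tg)   = ∘-preserves tf tg (preservesReducible tf) (preservesReducible tg)
preservesReducible (t-⊗ tf₁ tf₂) =
  ⊗-preserves tf₁ tf₂ (preservesReducible tf₁) (preservesReducible tf₂)
preservesReducible (t-⇒ A tf)    = ⇒-preserves A tf (preservesReducible tf)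

corollary4p17 : ∀ f → f ∶ I ⊢ I → Eq I I f (𝟙 I)
corollary4p17 f tf = begin
  f          ≈⟨ idʳ tf ⟨
  f ∘t 𝟙 I   ≈⟨ preservesReducible tf (≈-refl (t-𝟙 I)) ⟩
  𝟙 I        ∎
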